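{- Let $p$ be a prime and let $L=\langle a_1,p^{e_2}a_2,p^{e_3}a_3,\dots,p^{e_k}a_k\rangle$ be a regular diagonal $\mathbb{Z}$-lattice of rank $k\ge 4$ with $0\le e_2\le e_3\le\cdots\le e_k$ and $\gcd(p,a_1a_2\cdots a_k)=1$. Then: (i) if $p=2$ and $e_2\ge1$, then $\lambda_2(L)$ is a regular diagonal $\mathbb{Z}$-lattice; (ii) if $p=2$, $e_2=0$, $e_3\ge2$ and $a_1\equiv a_2\pmod 4$, then $\lambda_4(L)$ is a regular diagonal $\mathbb{Z}$-lattice; (iii) if $p=2$, $e_2=e_3=0$, $e_4\ge2$ and $a_1\equiv a_2\equiv a_3\pmod 4$, then $\lambda_4(L)$ is a regular diagonal $\mathbb{Z}$-lattice; (iv) if $p\neq2$ and $e_2\ge1$, then $\lambda_p(L)$ is a regular diagonal $\mathbb{Z}$-lattice; (v) if $p\neq2$, $e_2=0$, $e_3\ge1$ and $\left(\frac{ -a_1a_2}{p}\right)=-1$, then $\lambda_p(L)$ is a regular diagonal $\mathbb{Z}$-lattice.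
   Context: All $\mathbb{Z}$-lattices are positive definite and primitive (the scale, i.e. the ideal generated by all $B(\mathbf{x},\mathbf{y})$, is $\mathbb{Z}$); $Q(\mathbf{x})=B(\mathbf{x},\mathbf{x})$. $\langle b_1,\dots,b_k\rangle$ denotes a $\mathbb{Z}$-lattice with an orthogonal basis $\mathbf{x}_1,\dots,\mathbf{x}_k$ with $Q(\mathbf{x}_i)=b_i$; a lattice is called diagonal if it is isometric to such a lattice. A $\mathbb{Z}$-lattice $L$ is regular if every positive integer $n$ that is represented by $L\otimes\mathbb{Z}_q$ for every prime $q$ is represented by $L$. For a positive integer $m$, $\Lambda_m(L)=\{\mathbf{x}\in L: Q(\mathbf{x}+\mathbf{z})\equiv Q(\mathbf{z})\pmod m\text{ for all }\mathbf{z}\in L\}$ (a sublattice of $L$), and $\lambda_m(L)$ denotes the primitive $\mathbb{Z}$-lattice obtained from $\Lambda_m(L)$ by scaling the quadratic form by a suitable positive rational number. $\left(\frac{\cdot}{p}\right)$ is the Legendre symbol. -}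

module Defs where

open import Data.Nat as ℕ using (ℕ; zero; suc; _^_)
open import Data.Nat.Primality using (Prime)
open import Data.Integer as ℤ using (ℤ; +_; _+_; _*_; _-_; -_; _<_; 0ℤ)
open import Data.Integer.Divisibility using (_∣_)
open import Data.Fin using (Fin; zero; suc)
open import Data.Product using (Σ; ∃; _×_; _,_)
open import Relation.Binary.PropositionalEquality using (_≡_; _≢_)
open import Relation.Nullary using (¬_)
open import Function using (_∘_)
open import Function.Bundles using (_⇔_)

Vecℤ : ℕ → Set
Vecℤ k = Fin k → ℤ

Mat : ℕ → Set
Mat k = Fin k → Fin k → ℤ

sumFin : ∀ {k} → (Fin k → ℤ) → ℤ
sumFin {zero}  f = 0ℤ
sumFin {suc k} f = f zero + sumFin (f ∘ suc)

prodFinℕ : ∀ {k} → (Fin k → ℕ) → ℕ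
prodFinℕ {zero}  f = 1
prodFinℕ {suc k} f = f zero ℕ.* prodFinℕ (f ∘ suc)

apply : ∀ {k} → Mat k → Vecℤ k → Vecℤ k
apply M x i = sumFin (λ j → M i j * x j)

_⊕_ : ∀ {k} → Vecℤ k → Vecℤ k → Vecℤ k
(x ⊕ y) i = x i + y i

_≋_ : ∀ {k} → Vecℤ k → Vecℤ k → Set
x ≋ y = ∀ i → x i ≡ y i

-- ℤ-lattices of rank k, given by their Gram matrix w.r.t. a basis

B : ∀ {k} → Mat k → Vecℤ k → Vecℤ k → ℤ
B G x y = sumFin (λ i → sumFin (λ j → x i * G i j * y j))

Q : ∀ {k} → Mat k → Vecℤ k → ℤ
Q G x = B G x x

Symmetric : ∀ {k} → Mat k → Set
Symmetric G = ∀ i j → G i j ≡ G j i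

PosDef : ∀ {k} → Mat k → Set
PosDef G = ∀ x → ¬ (x ≋ (λ _ → 0ℤ)) → 0ℤ < Q G x

-- scale is ℤ: the only natural number dividing all B(x_i,x_j) is 1
Primitive : ∀ {k} → Mat k → Set
Primitive G = ∀ (d : ℕ) → (∀ i j → (+ d) ∣ G i j) → d ≡ 1

diagMat : ∀ {k} → (Fin k → ℤ) → Mat k
diagMat {suc k} b zero    zero    = b zero
diagMat {suc k} b zero    (suc j) = 0ℤ
diagMat {suc k} b (suc i) zero    = 0ℤ
diagMat {suc k} b (suc i) (suc j) = diagMat (b ∘ suc) i j

Isometric : ∀ {k} → Mat k → Mat k → Set
Isometric {k} G H =
  Σ (Mat k) λ T → Σ (Mat k) λ S →
    (∀ x → apply S (apply T x) ≋ x) × (∀ y → apply T (apply S y) ≋ y) ×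
    (∀ x y → B G (apply T x) (apply T y) ≡ B H x y)

Diagonal : ∀ {k} → Mat k → Set
Diagonal {k} G = Σ (Fin k → ℤ) λ b → Isometric G (diagMat b)

-- q-adic integers as the inverse limit lim ℤ/q^r ℤ (represented by
-- compatible sequences of integers) and local representation

record ℤ-adic (q : ℕ) : Set where
  field
    digitsUpTo : ℕ → ℤ
    compatible : ∀ r → (+ (q ^ r)) ∣ (digitsUpTo (suc r) - digitsUpTo r)
open ℤ-adic public

-- n is represented by L ⊗ ℤ_q: ∃ x ∈ ℤ_q^k with Q(x) = n in ℤ_q
LocRep : ∀ {k} → ℕ → Mat k → ℕ → Set
LocRep {k} q G n =
  Σ (Fin k → ℤ-adic q) λ x →
    ∀ r → (+ (q ^ r)) ∣ (Q G (λ i → digitsUpTo (x i) r) - + n)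

Represents : ∀ {k} → Mat k → ℕ → Set
Represents {k} G n = Σ (Vecℤ k) λ x → Q G x ≡ + n

Regular : ∀ {k} → Mat k → Set
Regular G = ∀ (n : ℕ) → 0 ℕ.< n → (∀ q → Prime q → LocRep q G n) → Represents G n

InΛ : ∀ {k} → ℕ → Mat k → Vecℤ k → Set
InΛ m G x = ∀ z → (+ m) ∣ (Q G (x ⊕ z) - Q G z)

-- H is (a Gram matrix of) λ_m(G): there is a basis T of Λ_m(G)
-- (T injective by positive definiteness, image exactly Λ_m(G)) such that
-- scaling B on Λ_m(G) by the positive rational u/v gives the primitive
-- lattice H.
IsLambda : ∀ {k} → ℕ → Mat k → Mat k → Set
IsLambda {k} m G H =
  Symmetric H × PosDef H × Primitive H ×
  Σ (Mat k) λ T →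
    (∀ y → InΛ m G y ⇔ Σ (Vecℤ k) (λ x → apply T x ≋ y)) ×
    Σ ℕ λ u → Σ ℕ λ v → 0 ℕ.< u × 0 ℕ.< v ×
      (∀ x y → + u * B G (apply T x) (apply T y) ≡ + v * B H x y)

LambdaRegularDiagonal : ∀ {k} → ℕ → Mat k → Set
LambdaRegularDiagonal {k} m G =
  Σ (Mat k) λ H → IsLambda m G H × Regular H × Diagonal H

LegendreMinusOne : ℤ → ℕ → Set
LegendreMinusOne a p = ¬ ((+ p) ∣ a) × (∀ (x : ℤ) → ¬ ((+ p) ∣ (x * x - a)))

-- Every case is one construction. Write L = ⟨g₁, …, gₖ⟩ with gᵢ = p^eᵢ aᵢ, call the first r
-- coordinates (where eᵢ = 0) the head, and scale the head basis vectors by tᵢ = p, the others by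
-- tᵢ = 1. If every vector of L whose norm is divisible by m has head coordinates divisible by p,
-- and every tᵢxᵢ lies in Λ_m(L), then Λ_m(L) = ⊕ ℤtᵢxᵢ, and dividing its form by c = p^j with
-- j = min(2, e_{r+1}) gives the primitive diagonal lattice with coefficients gᵢtᵢ²/c.
-- Regularity is inherited: if that lattice represents n everywhere locally, then L represents cn
-- everywhere locally, hence by some y, and m ∣ cn forces y into Λ_m(L). The hypotheses of the
-- five cases are what make the head condition hold: p ∤ a₁ for a head of size one, the
-- Legendre condition for size two, and a₁ ≡ a₂ (≡ a₃) (mod 4) when m = 4.

module Submission where

open import Defs
open import Data.Empty using (⊥-elim)
open import Data.Fin using (Fin; zero; suc; _↑ˡ_; _↑ʳ_; splitAt)
import Data.Fin as F
open import Data.Fin.Properties using (splitAt⁻¹-↑ˡ; splitAt⁻¹-↑ʳ)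
open import Data.Integer as ℤ using (ℤ; +_; -_; 0ℤ; 1ℤ; ∣_∣)
import Data.Integer.Divisibility.Signed as ℤ∣
import Data.Integer.Properties as ℤₚ
open import Data.Integer.Tactic.RingSolver using (solve-∀)
open import Data.Nat
  using (ℕ; zero; suc; _+_; _*_; _^_; _∸_; _≤_; _<_; _%_; z≤n; s≤s; NonZero; nonTrivial⇒≢1)
open import Data.Nat.Coprimality as Coprime using (Coprime; coprime-divisor; coprime-Bézout)
open import Data.Nat.DivMod using (%-distribˡ-+; %-distribˡ-*; [m+n]%n≡m%n; [m+kn]%n≡m%n; m%n<n; m<n⇒m%n≡m)
open import Data.Nat.Divisibility as ℕ∣ using (_∣_; divides)
open import Data.Nat.GCD using (module Bézout)
open import Data.Nat.Primality using (Prime; euclidsLemma; prime⇒irreducible; prime⇒nonZero; prime⇒nonTrivial)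
import Data.Nat.Properties as ℕₚ
open import Algebra.Properties.Semiring.Sum ℕₚ.+-*-semiring using (sum; sum-cong-≗; *-distribˡ-sum)
import Data.Nat.Tactic.RingSolver as ℕ-Ring
open import Data.Product using (Σ; _×_; _,_; proj₁; proj₂)
open import Data.Sum using (_⊎_; inj₁; inj₂; [_,_]′)
open import Data.Vec.Functional using (_++_; replicate)
open import Data.Vec.Functional.Properties using (lookup-++ˡ; lookup-++ʳ)
open import Function using (_∘_)
open import Function.Bundles using (mk⇔)
open import Relation.Binary.PropositionalEquality
open import Relation.Nullary using (¬_; yes; no)

sumFin-cong : ∀ {k} {f g : Fin k → ℤ} → (∀ i → f i ≡ g i) → sumFin f ≡ sumFin g
sumFin-cong {zero}  eq = refl
sumFin-cong {suc k} eq = cong₂ ℤ._+_ (eq zero) (sumFin-cong (eq ∘ suc))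

sumFin-zero : ∀ {k} {f : Fin k → ℤ} → (∀ i → f i ≡ 0ℤ) → sumFin f ≡ 0ℤ
sumFin-zero {zero}  f≡0 = refl
sumFin-zero {suc k} f≡0 = cong₂ ℤ._+_ (f≡0 zero) (sumFin-zero (f≡0 ∘ suc))

*-distribˡ-sumFin : ∀ {k} c (f : Fin k → ℤ) → c ℤ.* sumFin f ≡ sumFin (λ i → c ℤ.* f i)
*-distribˡ-sumFin {zero}  c f = ℤₚ.*-zeroʳ c
*-distribˡ-sumFin {suc k} c f =
  trans (ℤₚ.*-distribˡ-+ c (f zero) _) (cong (ℤ._+_ (c ℤ.* f zero)) (*-distribˡ-sumFin c (f ∘ suc)))

sumFin-minus : ∀ {k} (f g : Fin k → ℤ) → sumFin f ℤ.- sumFin g ≡ sumFin (λ i → f i ℤ.- g i)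
sumFin-minus {zero}  f g = refl
sumFin-minus {suc k} f g =
  trans (interchange (f zero) (sumFin (f ∘ suc)) (g zero) (sumFin (g ∘ suc)))
        (cong (ℤ._+_ (f zero ℤ.- g zero)) (sumFin-minus (f ∘ suc) (g ∘ suc)))
  where
  interchange : ∀ a b c d → (a ℤ.+ b) ℤ.- (c ℤ.+ d) ≡ (a ℤ.- c) ℤ.+ (b ℤ.- d)
  interchange = solve-∀

sumFin-pos : ∀ {k} (f : Fin k → ℕ) → sumFin (λ i → + f i) ≡ + sum f
sumFin-pos {zero}  f = refl
sumFin-pos {suc k} f =
  trans (cong (ℤ._+_ (+ f zero)) (sumFin-pos (f ∘ suc))) (sym (ℤₚ.pos-+ (f zero) (sum (f ∘ suc))))

∣-sumFin : ∀ {k d} {f : Fin k → ℤ} → (∀ i → d ℤ∣.∣ f i) → d ℤ∣.∣ sumFin f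
∣-sumFin {zero}  _ = ℤ∣.divides 0ℤ refl
∣-sumFin {suc k} d∣f = ℤ∣.∣m∣n⇒∣m+n (d∣f zero) (∣-sumFin (d∣f ∘ suc))

sum-splitAt : ∀ r {s} (f : Fin (r + s) → ℕ) → sum f ≡ sum (f ∘ (_↑ˡ s)) + sum (f ∘ (r ↑ʳ_))
sum-splitAt zero    f = refl
sum-splitAt (suc r) f = trans (cong (_+_ (f zero)) (sum-splitAt r (f ∘ suc))) (sym (ℕₚ.+-assoc (f zero) _ _))

∣-sum : ∀ {k d} {f : Fin k → ℕ} → (∀ i → d ∣ f i) → d ∣ sum f
∣-sum {zero}  _ = divides 0 refl
∣-sum {suc k} d∣f = ℕ∣.∣m∣n⇒∣m+n (d∣f zero) (∣-sum (d∣f ∘ suc))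

sum-%-cong : ∀ {k} {f g : Fin k → ℕ} n .{{_ : NonZero n}} →
             (∀ i → f i % n ≡ g i % n) → sum f % n ≡ sum g % n
sum-%-cong {zero}          n _   = refl
sum-%-cong {suc k} {f} {g} n f≡g = begin
  (f zero + sum (f ∘ suc)) % n              ≡⟨ %-distribˡ-+ (f zero) _ n ⟩
  (f zero % n + sum (f ∘ suc) % n) % n
    ≡⟨ cong₂ (λ u v → (u + v) % n) (f≡g zero) (sum-%-cong n (f≡g ∘ suc)) ⟩
  (g zero % n + sum (g ∘ suc) % n) % n      ≡⟨ %-distribˡ-+ (g zero) _ n ⟨
  (g zero + sum (g ∘ suc)) % n              ∎
  where open ≡-Reasoning

sum≤length : ∀ {k} {f : Fin k → ℕ} → (∀ i → f i ≤ 1) → sum f ≤ k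
sum≤length {zero}  _   = z≤n
sum≤length {suc k} f≤1 = ℕₚ.+-mono-≤ (f≤1 zero) (sum≤length (f≤1 ∘ suc))

sum≡0⇒≡0 : ∀ {k} (f : Fin k → ℕ) → sum f ≡ 0 → ∀ i → f i ≡ 0
sum≡0⇒≡0 f sum≡0 zero    = ℕₚ.m+n≡0⇒m≡0 (f zero) sum≡0
sum≡0⇒≡0 f sum≡0 (suc i) = sum≡0⇒≡0 (f ∘ suc) (ℕₚ.m+n≡0⇒n≡0 (f zero) sum≡0) i

↑-elim : ∀ r {s} {P : Fin (r + s) → Set} → (∀ i → P (i ↑ˡ s)) → (∀ i → P (r ↑ʳ i)) → ∀ i → P i
↑-elim r {P = P} head tail i with splitAt r i in eq
... | inj₁ i′ = subst P (splitAt⁻¹-↑ˡ eq) (head i′)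
... | inj₂ i′ = subst P (splitAt⁻¹-↑ʳ eq) (tail i′)

apply-diagMat : ∀ {k} (b : Fin k → ℤ) x i → apply (diagMat b) x i ≡ b i ℤ.* x i
apply-diagMat {suc k} b x zero =
  trans (cong (ℤ._+_ (b zero ℤ.* x zero)) (sumFin-zero (ℤₚ.*-zeroˡ ∘ x ∘ suc))) (ℤₚ.+-identityʳ _)
apply-diagMat {suc k} b x (suc i) =
  trans (cong₂ ℤ._+_ (ℤₚ.*-zeroˡ (x zero)) (apply-diagMat (b ∘ suc) (x ∘ suc) i)) (ℤₚ.+-identityˡ _)

B-diagMat : ∀ {k} (b : Fin k → ℤ) x y → B (diagMat b) x y ≡ sumFin (λ i → x i ℤ.* b i ℤ.* y i)
B-diagMat b x y = sumFin-cong λ i →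
  trans (sumFin-cong λ j → ℤₚ.*-assoc (x i) (diagMat b i j) (y j))
  (trans (sym (*-distribˡ-sumFin (x i) (λ j → diagMat b i j ℤ.* y j)))
  (trans (cong (ℤ._*_ (x i)) (apply-diagMat b y i)) (sym (ℤₚ.*-assoc (x i) (b i) (y i)))))

B-cong : ∀ {k} (G : Mat k) {x x′ y y′ : Vecℤ k} → x ≋ x′ → y ≋ y′ → B G x y ≡ B G x′ y′
B-cong G x≋x′ y≋y′ = sumFin-cong λ i → sumFin-cong λ j →
  cong₂ ℤ._*_ (cong (λ w → w ℤ.* G i j) (x≋x′ i)) (y≋y′ j)

Q-zero : ∀ {k} (G : Mat k) → Q G (λ _ → 0ℤ) ≡ 0ℤ
Q-zero G = sumFin-zero λ i → sumFin-zero λ j → ℤₚ.*-zeroʳ (0ℤ ℤ.* G i j)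

diagMat-symmetric : ∀ {k} (b : Fin k → ℤ) → Symmetric (diagMat b)
diagMat-symmetric {suc k} b zero    zero    = refl
diagMat-symmetric {suc k} b zero    (suc j) = refl
diagMat-symmetric {suc k} b (suc i) zero    = refl
diagMat-symmetric {suc k} b (suc i) (suc j) = diagMat-symmetric (b ∘ suc) i j

diagMat-diagonal : ∀ {k} (b : Fin k → ℤ) i → diagMat b i i ≡ b i
diagMat-diagonal {suc k} b zero    = refl
diagMat-diagonal {suc k} b (suc i) = diagMat-diagonal (b ∘ suc) i

diagMat-entry : ∀ {k} (b : Fin k → ℤ) i j → diagMat b i j ≡ b i ⊎ diagMat b i j ≡ 0ℤ
diagMat-entry {suc k} b zero    zero    = inj₁ refl
diagMat-entry {suc k} b zero    (suc j) = inj₂ refl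
diagMat-entry {suc k} b (suc i) zero    = inj₂ refl
diagMat-entry {suc k} b (suc i) (suc j) = diagMat-entry (b ∘ suc) i j

SetwiseCoprime : ∀ {k} → (Fin k → ℕ) → Set
SetwiseCoprime b = ∀ d → (∀ i → d ∣ b i) → d ≡ 1

primitive⇒setwiseCoprime : ∀ {k} (b : Fin k → ℕ) → Primitive (diagMat (λ i → + b i)) → SetwiseCoprime b
primitive⇒setwiseCoprime b isPrimitive d d∣b =
  isPrimitive d λ i j → d∣entry (diagMat-entry (λ i → + b i) i j)
  where
  d∣entry : ∀ {i z} → z ≡ + b i ⊎ z ≡ 0ℤ → d ∣ ∣ z ∣
  d∣entry (inj₁ refl) = d∣b _
  d∣entry (inj₂ refl) = divides 0 refl

setwiseCoprime⇒primitive : ∀ {k} (b : Fin k → ℕ) → SetwiseCoprime b → Primitive (diagMat (λ i → + b i))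
setwiseCoprime⇒primitive b coprime d d∣G =
  coprime d λ i → subst (λ z → d ∣ ∣ z ∣) (diagMat-diagonal (λ i → + b i) i) (d∣G i i)

square-abs : ∀ x → x ℤ.* x ≡ + (∣ x ∣ * ∣ x ∣)
square-abs (+ n)      = sym (ℤₚ.pos-* n n)
square-abs ℤ.-[1+ n ] = refl

Q-diagMat : ∀ {k} (b : Fin k → ℕ) y →
            Q (diagMat (λ i → + b i)) y ≡ + sum (λ i → b i * (∣ y i ∣ * ∣ y i ∣))
Q-diagMat b y = begin
  Q (diagMat (λ i → + b i)) y                        ≡⟨ B-diagMat (λ i → + b i) y y ⟩
  sumFin (λ i → y i ℤ.* + b i ℤ.* y i)               ≡⟨ sumFin-cong term ⟩
  sumFin (λ i → + (b i * (∣ y i ∣ * ∣ y i ∣)))        ≡⟨ sumFin-pos (λ i → b i * (∣ y i ∣ * ∣ y i ∣)) ⟩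
  + sum (λ i → b i * (∣ y i ∣ * ∣ y i ∣))             ∎
  where
  open ≡-Reasoning
  reorder : ∀ y b → y ℤ.* b ℤ.* y ≡ b ℤ.* (y ℤ.* y)
  reorder = solve-∀
  term : ∀ i → y i ℤ.* + b i ℤ.* y i ≡ + (b i * (∣ y i ∣ * ∣ y i ∣))
  term i = trans (reorder (y i) (+ b i))
          (trans (cong (ℤ._*_ (+ b i)) (square-abs (y i))) (sym (ℤₚ.pos-* (b i) _)))

sum-positive : ∀ {k} (b : Fin k → ℕ) → (∀ i → 0 < b i) → (y : Vecℤ k) → ¬ (y ≋ (λ _ → 0ℤ)) →
               0 < sum (λ i → b i * (∣ y i ∣ * ∣ y i ∣))
sum-positive {zero}  b b>0 y y≢0 = ⊥-elim (y≢0 λ ())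
sum-positive {suc k} b b>0 y y≢0 with y zero ℤ.≟ 0ℤ
... | yes y₀≡0 = ℕₚ.<-≤-trans (sum-positive (b ∘ suc) (b>0 ∘ suc) (y ∘ suc) tail≢0) (ℕₚ.m≤n+m _ _)
  where
  tail≢0 : ¬ ((y ∘ suc) ≋ (λ _ → 0ℤ))
  tail≢0 tail≡0 = y≢0 λ { zero → y₀≡0 ; (suc i) → tail≡0 i }
... | no y₀≢0 = ℕₚ.<-≤-trans (ℕₚ.*-mono-< (b>0 zero) (ℕₚ.*-mono-< ∣y₀∣>0 ∣y₀∣>0)) (ℕₚ.m≤m+n _ _)
  where
  ∣y₀∣>0 : 0 < ∣ y zero ∣
  ∣y₀∣>0 = ℕₚ.n≢0⇒n>0 (y₀≢0 ∘ ℤₚ.∣i∣≡0⇒i≡0)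

posDef-diagMat : ∀ {k} (b : Fin k → ℕ) → (∀ i → 0 < b i) → PosDef (diagMat (λ i → + b i))
posDef-diagMat b b>0 y y≢0 =
  subst (0ℤ ℤ.<_) (sym (Q-diagMat b y)) (ℤ.+<+ (sum-positive b b>0 y y≢0))

isometric-refl : ∀ {k} (G : Mat k) → Isometric G G
isometric-refl G = I , I , I² , I² , λ x y → B-cong G (I-id x) (I-id y)
  where
  I = diagMat (λ _ → 1ℤ)
  I-id : ∀ x → apply I x ≋ x
  I-id x i = trans (apply-diagMat (λ _ → 1ℤ) x i) (ℤₚ.*-identityˡ (x i))
  I² : ∀ x → apply I (apply I x) ≋ x
  I² x i = trans (I-id (apply I x) i) (I-id x i)

∣-*ˡ : ∀ {d} k a → d ∣ ∣ a ∣ → d ∣ ∣ k ℤ.* a ∣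
∣-*ˡ {d} k a d∣a = subst (d ∣_) (sym (ℤₚ.abs-* k a)) (ℕ∣.∣n⇒∣m*n ∣ k ∣ d∣a)

InΛ⇒∣Q : ∀ {k m} (G : Mat k) {y} → InΛ m G y → m ∣ ∣ Q G y ∣
InΛ⇒∣Q G {y} y∈Λ = subst (λ z → _ ∣ ∣ z ∣) Q[y+0]-Q[0]≡Q[y] (y∈Λ (λ _ → 0ℤ))
  where
  y+0≋y : (y ⊕ (λ _ → 0ℤ)) ≋ y
  y+0≋y i = ℤₚ.+-identityʳ (y i)
  Q[y+0]-Q[0]≡Q[y] : Q G (y ⊕ (λ _ → 0ℤ)) ℤ.- Q G (λ _ → 0ℤ) ≡ Q G y
  Q[y+0]-Q[0]≡Q[y] = trans (cong₂ ℤ._-_ (B-cong G y+0≋y y+0≋y) (Q-zero G)) (ℤₚ.+-identityʳ (Q G y))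

module Rescaling {k} (g h t : Fin k → ℕ) (c : ℕ) (scaled : ∀ i → g i * (t i * t i) ≡ c * h i) where

  G H T : Mat k
  G = diagMat (λ i → + g i)
  H = diagMat (λ i → + h i)
  T = diagMat (λ i → + t i)

  apply-T : ∀ x i → apply T x i ≡ + t i ℤ.* x i
  apply-T = apply-diagMat (λ i → + t i)

  B-rescaled : ∀ x y → B G (apply T x) (apply T y) ≡ + c ℤ.* B H x y
  B-rescaled x y = begin
    B G (apply T x) (apply T y)                           ≡⟨ B-diagMat _ (apply T x) (apply T y) ⟩
    sumFin (λ i → apply T x i ℤ.* + g i ℤ.* apply T y i)  ≡⟨ sumFin-cong term ⟩
    sumFin (λ i → + c ℤ.* (x i ℤ.* + h i ℤ.* y i))
      ≡⟨ *-distribˡ-sumFin (+ c) (λ i → x i ℤ.* + h i ℤ.* y i) ⟨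
    + c ℤ.* sumFin (λ i → x i ℤ.* + h i ℤ.* y i)           ≡⟨ cong (ℤ._*_ (+ c)) (B-diagMat _ x y) ⟨
    + c ℤ.* B H x y                                        ∎
    where
    open ≡-Reasoning
    scaledᶻ : ∀ i → + g i ℤ.* (+ t i ℤ.* + t i) ≡ + c ℤ.* + h i
    scaledᶻ i = begin
      + g i ℤ.* (+ t i ℤ.* + t i) ≡⟨ cong (ℤ._*_ (+ g i)) (ℤₚ.pos-* (t i) (t i)) ⟨
      + g i ℤ.* + (t i * t i)     ≡⟨ ℤₚ.pos-* (g i) (t i * t i) ⟨
      + (g i * (t i * t i))       ≡⟨ cong +_ (scaled i) ⟩
      + (c * h i)                 ≡⟨ ℤₚ.pos-* c (h i) ⟩
      + c ℤ.* + h i               ∎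
    rearrange : ∀ t x g y → t ℤ.* x ℤ.* g ℤ.* (t ℤ.* y) ≡ g ℤ.* (t ℤ.* t) ℤ.* (x ℤ.* y)
    rearrange = solve-∀
    regroup : ∀ c h x y → c ℤ.* h ℤ.* (x ℤ.* y) ≡ c ℤ.* (x ℤ.* h ℤ.* y)
    regroup = solve-∀
    term : ∀ i → apply T x i ℤ.* + g i ℤ.* apply T y i ≡ + c ℤ.* (x i ℤ.* + h i ℤ.* y i)
    term i = begin
      apply T x i ℤ.* + g i ℤ.* apply T y i
        ≡⟨ cong₂ (λ u v → u ℤ.* + g i ℤ.* v) (apply-T x i) (apply-T y i) ⟩
      + t i ℤ.* x i ℤ.* + g i ℤ.* (+ t i ℤ.* y i)   ≡⟨ rearrange (+ t i) (x i) (+ g i) (y i) ⟩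
      + g i ℤ.* (+ t i ℤ.* + t i) ℤ.* (x i ℤ.* y i) ≡⟨ cong (λ u → u ℤ.* (x i ℤ.* y i)) (scaledᶻ i) ⟩
      + c ℤ.* + h i ℤ.* (x i ℤ.* y i)              ≡⟨ regroup (+ c) (+ h i) (x i) (y i) ⟩
      + c ℤ.* (x i ℤ.* + h i ℤ.* y i)              ∎

  shift-term : Vecℤ k → Vecℤ k → Fin k → ℤ
  shift-term x z i = + (g i * (t i * t i)) ℤ.* (x i ℤ.* x i) ℤ.+ + (g i * (t i + t i)) ℤ.* (x i ℤ.* z i)

  Q-shift : ∀ x z → Q G (apply T x ⊕ z) ℤ.- Q G z ≡ sumFin (shift-term x z)
  Q-shift x z = begin
    Q G (apply T x ⊕ z) ℤ.- Q G z
      ≡⟨ cong₂ ℤ._-_ (B-diagMat _ (apply T x ⊕ z) (apply T x ⊕ z)) (B-diagMat _ z z) ⟩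
    sumFin (λ i → (apply T x ⊕ z) i ℤ.* + g i ℤ.* (apply T x ⊕ z) i)
      ℤ.- sumFin (λ i → z i ℤ.* + g i ℤ.* z i)
      ≡⟨ sumFin-minus {k} _ _ ⟩
    sumFin (λ i → (apply T x ⊕ z) i ℤ.* + g i ℤ.* (apply T x ⊕ z) i ℤ.- z i ℤ.* + g i ℤ.* z i)
      ≡⟨ sumFin-cong term ⟩
    sumFin (shift-term x z) ∎
    where
    open ≡-Reasoning
    expand : ∀ t x g z → (t ℤ.* x ℤ.+ z) ℤ.* g ℤ.* (t ℤ.* x ℤ.+ z) ℤ.- z ℤ.* g ℤ.* z
                         ≡ g ℤ.* (t ℤ.* t) ℤ.* (x ℤ.* x) ℤ.+ g ℤ.* (t ℤ.+ t) ℤ.* (x ℤ.* z)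
    expand = solve-∀
    term : ∀ i → (apply T x ⊕ z) i ℤ.* + g i ℤ.* (apply T x ⊕ z) i ℤ.- z i ℤ.* + g i ℤ.* z i
                 ≡ shift-term x z i
    term i = begin
      (apply T x i ℤ.+ z i) ℤ.* + g i ℤ.* (apply T x i ℤ.+ z i) ℤ.- z i ℤ.* + g i ℤ.* z i
        ≡⟨ cong (λ w → (w ℤ.+ z i) ℤ.* + g i ℤ.* (w ℤ.+ z i) ℤ.- z i ℤ.* + g i ℤ.* z i) (apply-T x i) ⟩
      (+ t i ℤ.* x i ℤ.+ z i) ℤ.* + g i ℤ.* (+ t i ℤ.* x i ℤ.+ z i) ℤ.- z i ℤ.* + g i ℤ.* z i
        ≡⟨ expand (+ t i) (x i) (+ g i) (z i) ⟩
      + g i ℤ.* (+ t i ℤ.* + t i) ℤ.* (x i ℤ.* x i) ℤ.+ + g i ℤ.* (+ t i ℤ.+ + t i) ℤ.* (x i ℤ.* z i)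
        ≡⟨ cong₂ (λ u v → u ℤ.* (x i ℤ.* x i) ℤ.+ v ℤ.* (x i ℤ.* z i))
                 (trans (ℤₚ.pos-* (g i) (t i * t i)) (cong (ℤ._*_ (+ g i)) (ℤₚ.pos-* (t i) (t i))))
                 (trans (ℤₚ.pos-* (g i) (t i + t i)) (cong (ℤ._*_ (+ g i)) (ℤₚ.pos-+ (t i) (t i)))) ⟨
      shift-term x z i ∎

  t∣⇒∈span : ∀ {y} → (∀ i → t i ∣ ∣ y i ∣) → Σ (Vecℤ k) λ x → apply T x ≋ y
  t∣⇒∈span {y} t∣y =
    x , λ i → trans (apply-T x i) (trans (ℤₚ.*-comm (+ t i) (x i)) (sym (ℤ∣._∣_.equality (t∣yᶻ i))))
    where
    t∣yᶻ : ∀ i → + t i ℤ∣.∣ y i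
    t∣yᶻ i = ℤ∣.∣ᵤ⇒∣ (t∣y i)
    x : Vecℤ k
    x i = ℤ∣._∣_.quotient (t∣yᶻ i)

  ScaledBasisInΛ : ℕ → Set
  ScaledBasisInΛ m = ∀ i → (m ∣ g i * (t i * t i)) × (m ∣ g i * (t i + t i))

  DivisibleNormInSpan : ℕ → Set
  DivisibleNormInSpan m = ∀ y → m ∣ ∣ Q G y ∣ → ∀ i → t i ∣ ∣ y i ∣

  span⊆Λ : ∀ m → ScaledBasisInΛ m → ∀ {y} → Σ (Vecℤ k) (λ x → apply T x ≋ y) → InΛ m G y
  span⊆Λ m tᵢeᵢ∈Λ {y} (x , Tx≋y) z = subst (λ w → m ∣ ∣ w ∣) Q-shift′ (ℤ∣.∣⇒∣ᵤ (∣-sumFin m∣term))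
    where
    m∣term : ∀ i → + m ℤ∣.∣ shift-term x z i
    m∣term i =
      ℤ∣.∣m∣n⇒∣m+n (ℤ∣.∣m⇒∣m*n {m = + (g i * (t i * t i))} (x i ℤ.* x i) (ℤ∣.∣ᵤ⇒∣ (proj₁ (tᵢeᵢ∈Λ i))))
                   (ℤ∣.∣m⇒∣m*n {m = + (g i * (t i + t i))} (x i ℤ.* z i) (ℤ∣.∣ᵤ⇒∣ (proj₂ (tᵢeᵢ∈Λ i))))
    Tx⊕z≋y⊕z : (apply T x ⊕ z) ≋ (y ⊕ z)
    Tx⊕z≋y⊕z i = cong (λ w → w ℤ.+ z i) (Tx≋y i)
    Q-shift′ : sumFin (shift-term x z) ≡ Q G (y ⊕ z) ℤ.- Q G z
    Q-shift′ = trans (sym (Q-shift x z)) (cong (λ w → w ℤ.- Q G z) (B-cong G Tx⊕z≋y⊕z Tx⊕z≋y⊕z))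

  local-rescaled : ∀ {q n} → LocRep q H n → LocRep q G (c * n)
  local-rescaled {q} {n} (x , x-represents) = Tx , Tx-represents
    where
    open ≡-Reasoning
    factor : ∀ k a b → k ℤ.* a ℤ.- k ℤ.* b ≡ k ℤ.* (a ℤ.- b)
    factor = solve-∀
    digits : ℕ → Vecℤ k
    digits r i = digitsUpTo (x i) r
    Tx : Fin k → ℤ-adic q
    Tx i = record
      { digitsUpTo = λ r → + t i ℤ.* digits r i
      ; compatible = λ r →
          subst (λ z → q ^ r ∣ ∣ z ∣) (sym (factor (+ t i) (digits (suc r) i) (digits r i)))
                (∣-*ˡ (+ t i) (digits (suc r) i ℤ.- digits r i) (compatible (x i) r))
      }
    Tx-represents : ∀ r → q ^ r ∣ ∣ Q G (λ i → + t i ℤ.* digits r i) ℤ.- + (c * n) ∣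
    Tx-represents r =
      subst (λ z → q ^ r ∣ ∣ z ∣) (sym rescaled) (∣-*ˡ (+ c) (Q H (digits r) ℤ.- + n) (x-represents r))
      where
      Td≋ : (λ i → + t i ℤ.* digits r i) ≋ apply T (digits r)
      Td≋ i = sym (apply-T (digits r) i)
      rescaled : Q G (λ i → + t i ℤ.* digits r i) ℤ.- + (c * n) ≡ + c ℤ.* (Q H (digits r) ℤ.- + n)
      rescaled = begin
        Q G (λ i → + t i ℤ.* digits r i) ℤ.- + (c * n)
          ≡⟨ cong₂ ℤ._-_ (B-cong G Td≋ Td≋) (ℤₚ.pos-* c n) ⟩
        B G (apply T (digits r)) (apply T (digits r)) ℤ.- + c ℤ.* + n
          ≡⟨ cong (λ z → z ℤ.- + c ℤ.* + n) (B-rescaled (digits r) (digits r)) ⟩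
        + c ℤ.* Q H (digits r) ℤ.- + c ℤ.* + n
          ≡⟨ factor (+ c) (Q H (digits r)) (+ n) ⟩
        + c ℤ.* (Q H (digits r) ℤ.- + n) ∎

  module _ (m : ℕ) (m∣Q⇒t∣ : DivisibleNormInSpan m) where

    Λ⊆span : ∀ {y} → InΛ m G y → Σ (Vecℤ k) λ x → apply T x ≋ y
    Λ⊆span {y} y∈Λ = t∣⇒∈span (m∣Q⇒t∣ y (InΛ⇒∣Q {m = m} G {y} y∈Λ))

    represents-rescaled : ∀ {n} → 0 < c → m ∣ c → Represents G (c * n) → Represents H n
    represents-rescaled {n} (s≤s _) m∣c (y , Qy≡cn) = x , Qx≡n
      where
      open ≡-Reasoning
      m∣Qy : m ∣ ∣ Q G y ∣
      m∣Qy = subst (λ z → m ∣ ∣ z ∣) (sym Qy≡cn) (ℕ∣.∣-trans m∣c (ℕ∣.m∣m*n n))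
      x = proj₁ (t∣⇒∈span {y} (m∣Q⇒t∣ y m∣Qy))
      Tx≋y : apply T x ≋ y
      Tx≋y = proj₂ (t∣⇒∈span {y} (m∣Q⇒t∣ y m∣Qy))
      Qx≡n : Q H x ≡ + n
      Qx≡n = ℤₚ.*-cancelˡ-≡ (+ c) (Q H x) (+ n) (begin
        + c ℤ.* Q H x                ≡⟨ B-rescaled x x ⟨
        B G (apply T x) (apply T x)  ≡⟨ B-cong G Tx≋y Tx≋y ⟩
        Q G y                        ≡⟨ Qy≡cn ⟩
        + (c * n)                    ≡⟨ ℤₚ.pos-* c n ⟩
        + c ℤ.* + n                  ∎)

    regular-rescaled : 0 < c → m ∣ c → Regular G → Regular H
    regular-rescaled c>0 m∣c regular n n>0 local =
      represents-rescaled c>0 m∣c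
        (regular (c * n) (ℕₚ.*-mono-< c>0 n>0) λ q q-prime → local-rescaled (local q q-prime))

  λ-rescaled : ∀ m → (∀ i → 0 < h i) → 0 < c → SetwiseCoprime h → m ∣ c →
               ScaledBasisInΛ m → DivisibleNormInSpan m → Regular G → LambdaRegularDiagonal m G
  λ-rescaled m h>0 c>0 h-coprime m∣c tᵢeᵢ∈Λ m∣Q⇒t∣ regular =
    H , (diagMat-symmetric _ , posDef-diagMat h h>0 , setwiseCoprime⇒primitive h h-coprime , T ,
         (λ y → mk⇔ (Λ⊆span m m∣Q⇒t∣) (span⊆Λ m tᵢeᵢ∈Λ)) ,
         1 , c , s≤s z≤n , c>0 , λ x y → trans (ℤₚ.*-identityˡ _) (B-rescaled x y))
      , regular-rescaled m m∣Q⇒t∣ c>0 m∣c regular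
      , (λ i → + h i) , isometric-refl H

m^n∣m^o : ∀ m {n o} → n ≤ o → m ^ n ∣ m ^ o
m^n∣m^o m {n} {o} n≤o = divides (m ^ (o ∸ n)) (begin
  m ^ o                ≡⟨ cong (m ^_) (ℕₚ.m+[n∸m]≡n n≤o) ⟨
  m ^ (n + (o ∸ n))    ≡⟨ ℕₚ.^-distribˡ-+-* m n (o ∸ n) ⟩
  m ^ n * m ^ (o ∸ n)  ≡⟨ ℕₚ.*-comm (m ^ n) _ ⟩
  m ^ (o ∸ n) * m ^ n  ∎)
  where open ≡-Reasoning

coprime-divisor-^ : ∀ {d p} n {x} → Coprime d p → d ∣ p ^ n * x → d ∣ x
coprime-divisor-^ {d}         zero    {x} _       d∣x  = subst (d ∣_) (ℕₚ.*-identityˡ x) d∣x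
coprime-divisor-^ {d} {p = p} (suc n) {x} coprime d∣px =
  coprime-divisor-^ n coprime (coprime-divisor coprime (subst (d ∣_) (ℕₚ.*-assoc p (p ^ n) x) d∣px))

prime∤⇒coprime : ∀ {p n} → Prime p → ¬ p ∣ n → Coprime p n
prime∤⇒coprime p-prime p∤n (d∣p , d∣n) with prime⇒irreducible p-prime d∣p
... | inj₁ d≡1 = d≡1
... | inj₂ refl = ⊥-elim (p∤n d∣n)

module PowerRescaling {k} (p : ℕ) (a e δ : Fin k → ℕ) (j : ℕ) where

  -- the exponent of p in gᵢ tᵢ²
  κ : Fin k → ℕ
  κ i = e i + δ i + δ i

  g t h : Fin k → ℕ
  g i = p ^ e i * a i
  t i = p ^ δ i
  h i = p ^ (κ i ∸ j) * a i

  g*t²≡p^j*h : (∀ i → j ≤ κ i) → ∀ i → g i * (t i * t i) ≡ p ^ j * h i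
  g*t²≡p^j*h j≤κ i = begin
    p ^ e i * a i * (p ^ δ i * p ^ δ i)   ≡⟨ regroup (p ^ e i) (a i) (p ^ δ i) ⟩
    p ^ e i * p ^ δ i * p ^ δ i * a i     ≡⟨ cong (_* a i) p^κ≡ ⟨
    p ^ κ i * a i                         ≡⟨ cong (λ z → p ^ z * a i) (ℕₚ.m+[n∸m]≡n (j≤κ i)) ⟨
    p ^ (j + (κ i ∸ j)) * a i             ≡⟨ cong (_* a i) (ℕₚ.^-distribˡ-+-* p j (κ i ∸ j)) ⟩
    p ^ j * p ^ (κ i ∸ j) * a i           ≡⟨ ℕₚ.*-assoc (p ^ j) _ (a i) ⟩
    p ^ j * (p ^ (κ i ∸ j) * a i)         ∎
    where
    open ≡-Reasoning
    regroup : ∀ x a y → x * a * (y * y) ≡ x * y * y * a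
    regroup = ℕ-Ring.solve-∀
    p^κ≡ : p ^ κ i ≡ p ^ e i * p ^ δ i * p ^ δ i
    p^κ≡ = trans (ℕₚ.^-distribˡ-+-* p (e i + δ i) (δ i))
                 (cong (_* p ^ δ i) (ℕₚ.^-distribˡ-+-* p (e i) (δ i)))

  h-positive : Prime p → (∀ i → 0 < a i) → ∀ i → 0 < h i
  h-positive p-prime a>0 i = ℕₚ.*-mono-< (ℕₚ.m^n>0 p {{prime⇒nonZero p-prime}} (κ i ∸ j)) (a>0 i)

  h-setwiseCoprime : Prime p → (∀ i → ¬ p ∣ a i) → Σ (Fin k) (λ i₀ → κ i₀ ≡ j) →
                     SetwiseCoprime g → SetwiseCoprime h
  h-setwiseCoprime p-prime p∤a (i₀ , κ≡j) g-coprime d d∣h =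
    g-coprime d λ i → ℕ∣.∣n⇒∣m*n (p ^ e i) (d∣a i)
    where
    d∣a₀ : d ∣ a i₀
    d∣a₀ = subst (d ∣_) (trans (cong (λ z → p ^ z * a i₀) κ₀∸j≡0) (ℕₚ.*-identityˡ (a i₀))) (d∣h i₀)
      where
      κ₀∸j≡0 : κ i₀ ∸ j ≡ 0
      κ₀∸j≡0 = trans (cong (_∸ j) κ≡j) (ℕₚ.n∸n≡0 j)
    d⊥p : Coprime d p
    d⊥p = Coprime.sym (prime∤⇒coprime p-prime λ p∣d → p∤a i₀ (ℕ∣.∣-trans p∣d d∣a₀))
    d∣a : ∀ i → d ∣ a i
    d∣a i = coprime-divisor-^ (κ i ∸ j) d⊥p (d∣h i)

Anisotropic : ℕ → ℕ → ∀ {r} → (Fin r → ℕ) → Set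
Anisotropic m p {r} b = ∀ (Y : Fin r → ℕ) → m ∣ sum (λ i → b i * (Y i * Y i)) → ∀ i → p ∣ Y i

euclid-square : ∀ {p b} Y → Prime p → ¬ p ∣ b → p ∣ b * (Y * Y) → p ∣ Y
euclid-square {b = b} Y p-prime p∤b p∣bY² with euclidsLemma b (Y * Y) p-prime p∣bY²
... | inj₁ p∣b = ⊥-elim (p∤b p∣b)
... | inj₂ p∣Y² with euclidsLemma Y Y p-prime p∣Y²
...   | inj₁ p∣Y = p∣Y
...   | inj₂ p∣Y = p∣Y

anisotropic-rank-1 : ∀ {p} (b : Fin 1 → ℕ) → Prime p → ¬ p ∣ b zero → Anisotropic p p b
anisotropic-rank-1 {p} b p-prime p∤b Y p∣sum zero =
  euclid-square (Y zero) p-prime p∤b (subst (p ∣_) (ℕₚ.+-identityʳ _) p∣sum)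

pos-1+* : ∀ m n → + (1 + m * n) ≡ 1ℤ ℤ.+ + m ℤ.* + n
pos-1+* m n = trans (ℤₚ.pos-+ 1 (m * n)) (cong (ℤ._+_ 1ℤ) (ℤₚ.pos-* m n))

inverse-mod-prime : ∀ {p n} → Prime p → ¬ p ∣ n → Σ ℤ λ u → + p ℤ∣.∣ u ℤ.* + n ℤ.- 1ℤ
inverse-mod-prime {p} {n} p-prime p∤n with coprime-Bézout (prime∤⇒coprime p-prime p∤n)
... | Bézout.+- x y 1+yn≡xp = - + y , ℤ∣.divides (- + x) (begin
  - + y ℤ.* + n ℤ.- 1ℤ      ≡⟨ negate (+ y) (+ n) ⟩
  - (1ℤ ℤ.+ + y ℤ.* + n)   ≡⟨ cong -_ (pos-1+* y n) ⟨
  - + (1 + y * n)          ≡⟨ cong (λ z → - + z) 1+yn≡xp ⟩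
  - + (x * p)              ≡⟨ cong -_ (ℤₚ.pos-* x p) ⟩
  - (+ x ℤ.* + p)          ≡⟨ ℤₚ.neg-distribˡ-* (+ x) (+ p) ⟩
  - + x ℤ.* + p            ∎)
  where
  open ≡-Reasoning
  negate : ∀ y n → - y ℤ.* n ℤ.- 1ℤ ≡ - (1ℤ ℤ.+ y ℤ.* n)
  negate = solve-∀
... | Bézout.-+ x y 1+xp≡yn = + y , ℤ∣.divides (+ x) (begin
  + y ℤ.* + n ℤ.- 1ℤ               ≡⟨ cong (λ z → z ℤ.- 1ℤ) (ℤₚ.pos-* y n) ⟨
  + (y * n) ℤ.- 1ℤ                 ≡⟨ cong (λ z → + z ℤ.- 1ℤ) 1+xp≡yn ⟨
  + (1 + x * p) ℤ.- 1ℤ             ≡⟨ cong (λ z → z ℤ.- 1ℤ) (pos-1+* x p) ⟩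
  1ℤ ℤ.+ + x ℤ.* + p ℤ.- 1ℤ        ≡⟨ cancel (+ x ℤ.* + p) ⟩
  + x ℤ.* + p                      ∎)
  where
  open ≡-Reasoning
  cancel : ∀ z → 1ℤ ℤ.+ z ℤ.- 1ℤ ≡ z
  cancel = solve-∀

-- If p ∤ Y₁ and uY₁ ≡ 1, then x = b₀Y₀u satisfies x² ≡ -b₀b₁ (mod p).
legendre⇒∣Y₁ : ∀ {p} b₀ b₁ Y₀ Y₁ → Prime p → LegendreMinusOne (- (+ (b₀ * b₁))) p →
               p ∣ b₀ * (Y₀ * Y₀) + b₁ * (Y₁ * Y₁) → p ∣ Y₁
legendre⇒∣Y₁ {p} b₀ b₁ Y₀ Y₁ p-prime (_ , nonresidue) p∣form with p ℕ∣.∣? Y₁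
... | yes p∣Y₁ = p∣Y₁
... | no p∤Y₁ = ⊥-elim (nonresidue x (ℤ∣.∣⇒∣ᵤ p∣x²+b₀b₁))
  where
  u = proj₁ (inverse-mod-prime p-prime p∤Y₁)
  p∣uY₁-1 : + p ℤ∣.∣ u ℤ.* + Y₁ ℤ.- 1ℤ
  p∣uY₁-1 = proj₂ (inverse-mod-prime p-prime p∤Y₁)
  x = + b₀ ℤ.* + Y₀ ℤ.* u
  identity : ∀ b₀ b₁ Y₀ Y₁ u →
    (b₀ ℤ.* Y₀ ℤ.* u) ℤ.* (b₀ ℤ.* Y₀ ℤ.* u) ℤ.- - (b₀ ℤ.* b₁)
      ≡ b₀ ℤ.* u ℤ.* u ℤ.* (b₀ ℤ.* (Y₀ ℤ.* Y₀) ℤ.+ b₁ ℤ.* (Y₁ ℤ.* Y₁))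
        ℤ.- b₀ ℤ.* b₁ ℤ.* (u ℤ.* Y₁ ℤ.+ 1ℤ) ℤ.* (u ℤ.* Y₁ ℤ.- 1ℤ)
  identity = solve-∀
  pos-*² : ∀ c y → + (c * (y * y)) ≡ + c ℤ.* (+ y ℤ.* + y)
  pos-*² c y = trans (ℤₚ.pos-* c (y * y)) (cong (ℤ._*_ (+ c)) (ℤₚ.pos-* y y))
  p∣formᶻ : + p ℤ∣.∣ + b₀ ℤ.* (+ Y₀ ℤ.* + Y₀) ℤ.+ + b₁ ℤ.* (+ Y₁ ℤ.* + Y₁)
  p∣formᶻ = subst (ℤ∣._∣_ (+ p))
              (trans (ℤₚ.pos-+ (b₀ * (Y₀ * Y₀)) _) (cong₂ ℤ._+_ (pos-*² b₀ Y₀) (pos-*² b₁ Y₁)))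
              (ℤ∣.∣ᵤ⇒∣ p∣form)
  p∣x²+b₀b₁ : + p ℤ∣.∣ x ℤ.* x ℤ.- - + (b₀ * b₁)
  p∣x²+b₀b₁ = subst (ℤ∣._∣_ (+ p))
    (sym (trans (cong (λ z → x ℤ.* x ℤ.- - z) (ℤₚ.pos-* b₀ b₁)) (identity (+ b₀) (+ b₁) (+ Y₀) (+ Y₁) u)))
    (ℤ∣.∣m∣n⇒∣m-n (ℤ∣.∣n⇒∣m*n (+ b₀ ℤ.* u ℤ.* u) p∣formᶻ)
                  (ℤ∣.∣n⇒∣m*n (+ b₀ ℤ.* + b₁ ℤ.* (u ℤ.* + Y₁ ℤ.+ 1ℤ)) p∣uY₁-1))

legendre⇒anisotropic : ∀ {p} (b : Fin 2 → ℕ) → Prime p →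
                       LegendreMinusOne (- (+ (b zero * b (suc zero)))) p → Anisotropic p p b
legendre⇒anisotropic {p} b p-prime legendre Y p∣sum = λ { zero → p∣Y₀ ; (suc zero) → p∣Y₁ }
  where
  b₀ = b zero
  b₁ = b (suc zero)
  Y₀ = Y zero
  Y₁ = Y (suc zero)
  p∣form : p ∣ b₀ * (Y₀ * Y₀) + b₁ * (Y₁ * Y₁)
  p∣form = subst (λ z → p ∣ b₀ * (Y₀ * Y₀) + z) (ℕₚ.+-identityʳ _) p∣sum
  p∤b₀ : ¬ p ∣ b₀
  p∤b₀ p∣b₀ = proj₁ legendre (subst (p ∣_) (sym (ℤₚ.∣-i∣≡∣i∣ (+ (b₀ * b₁)))) (ℕ∣.∣m⇒∣m*n b₁ p∣b₀))
  p∣Y₁ : p ∣ Y₁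
  p∣Y₁ = legendre⇒∣Y₁ b₀ b₁ Y₀ Y₁ p-prime legendre p∣form
  p∣Y₀ : p ∣ Y₀
  p∣Y₀ = euclid-square Y₀ p-prime p∤b₀
           (ℕ∣.∣m+n∣m⇒∣n (subst (p ∣_) (ℕₚ.+-comm (b₀ * (Y₀ * Y₀)) _) p∣form)
                         (ℕ∣.∣n⇒∣m*n b₁ (ℕ∣.∣m⇒∣m*n Y₁ p∣Y₁)))

square%4≡%2 : ∀ n → n * n % 4 ≡ n % 2
square%4≡%2 0             = refl
square%4≡%2 1             = refl
square%4≡%2 (suc (suc n)) = begin
  (2 + n) * (2 + n) % 4       ≡⟨ cong (_% 4) (expand n) ⟩
  (n * n + (1 + n) * 4) % 4   ≡⟨ [m+kn]%n≡m%n (n * n) (1 + n) 4 ⟩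
  n * n % 4                   ≡⟨ square%4≡%2 n ⟩
  n % 2                       ≡⟨ [m+n]%n≡m%n n 2 ⟨
  (n + 2) % 2                 ≡⟨ cong (_% 2) (ℕₚ.+-comm n 2) ⟩
  (2 + n) % 2                 ∎
  where
  open ≡-Reasoning
  expand : ∀ n → (2 + n) * (2 + n) ≡ n * n + (1 + n) * 4
  expand = ℕ-Ring.solve-∀

4∣odd*n⇒n≡0 : ∀ {ρ n} → ¬ 2 ∣ ρ → n < 4 → 4 ∣ ρ * n → n ≡ 0
4∣odd*n⇒n≡0 {n = 0} _ _ _ = refl
4∣odd*n⇒n≡0 {ρ} {1} ρ-odd _ 4∣ρ =
  ⊥-elim (ρ-odd (ℕ∣.∣-trans (divides 2 refl) (subst (4 ∣_) (ℕₚ.*-identityʳ ρ) 4∣ρ)))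
4∣odd*n⇒n≡0 {ρ} {2} ρ-odd _ 4∣2ρ = ⊥-elim (ρ-odd (ℕ∣.*-cancelʳ-∣ 2 4∣2ρ))
4∣odd*n⇒n≡0 {ρ} {3} ρ-odd _ 4∣3ρ = ⊥-elim (ρ-odd (ℕ∣.∣-trans (divides 2 refl) 4∣ρ))
  where
  4∣ρ : 4 ∣ ρ
  4∣ρ = ℕ∣.∣m+n∣m⇒∣n (subst (4 ∣_) (trans (ℕₚ.*-suc ρ 3) (ℕₚ.+-comm ρ (ρ * 3))) (ℕ∣.n∣m*n ρ)) 4∣3ρ
4∣odd*n⇒n≡0 {n = suc (suc (suc (suc _)))} _ (s≤s (s≤s (s≤s (s≤s ())))) _

-- Since a square is congruent to its parity mod 4, b[Y] ≡ ρ · #{i | Yᵢ odd} (mod 4),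
-- and that count is less than 4.
anisotropic-mod-4 : ∀ {r} (b : Fin r → ℕ) ρ → ¬ 2 ∣ ρ → (∀ i → b i % 4 ≡ ρ % 4) → r < 4 →
                    Anisotropic 4 2 b
anisotropic-mod-4 {r} b ρ ρ-odd b≡ρ r<4 Y 4∣sum i =
  ℕ∣.m%n≡0⇒n∣m (Y i) 2 (sum≡0⇒≡0 parity odd-count≡0 i)
  where
  open ≡-Reasoning
  parity : Fin r → ℕ
  parity i = Y i % 2
  parity≤1 : ∀ i → parity i ≤ 1
  parity≤1 i = ℕₚ.≤-pred (m%n<n (Y i) 2)
  term≡ : ∀ i → b i * (Y i * Y i) % 4 ≡ ρ * parity i % 4
  term≡ i = begin
    b i * (Y i * Y i) % 4               ≡⟨ %-distribˡ-* (b i) (Y i * Y i) 4 ⟩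
    b i % 4 * (Y i * Y i % 4) % 4
      ≡⟨ cong₂ (λ u v → u * v % 4) (b≡ρ i) (trans (square%4≡%2 (Y i)) parity≡) ⟩
    ρ % 4 * (parity i % 4) % 4          ≡⟨ %-distribˡ-* ρ (parity i) 4 ⟨
    ρ * parity i % 4                    ∎
    where
    parity≡ : parity i ≡ parity i % 4
    parity≡ = sym (m<n⇒m%n≡m (ℕₚ.≤-trans (s≤s (parity≤1 i)) (s≤s (s≤s z≤n))))
  4∣ρ*count : 4 ∣ ρ * sum parity
  4∣ρ*count = ℕ∣.m%n≡0⇒n∣m _ 4 (begin
    ρ * sum parity % 4                  ≡⟨ cong (_% 4) (*-distribˡ-sum ρ parity) ⟩
    sum (λ i → ρ * parity i) % 4        ≡⟨ sum-%-cong 4 term≡ ⟨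
    sum (λ i → b i * (Y i * Y i)) % 4   ≡⟨ ℕ∣.n∣m⇒m%n≡0 _ 4 4∣sum ⟩
    0                                   ∎)
  odd-count≡0 : sum parity ≡ 0
  odd-count≡0 = 4∣odd*n⇒n≡0 ρ-odd (ℕₚ.≤-<-trans (sum≤length parity≤1) r<4) 4∣ρ*count

module HeadRescaling {r s p} (p-prime : Prime p) (a e : Fin (r + s) → ℕ)
  (a>0 : ∀ i → 0 < a i) (p∤a : ∀ i → ¬ p ∣ a i) (e-head : ∀ i → e (i ↑ˡ s) ≡ 0)
  (m j : ℕ) (j≤2 : j ≤ 2) (j≤e-tail : ∀ i → j ≤ e (r ↑ʳ i)) (m∣p^j : m ∣ p ^ j) (m∣p+p : m ∣ p + p)
  (head-anisotropic : Anisotropic m p (λ i → a (i ↑ˡ s)))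
  -- j is the least exponent κ, attained on the head (κ = 2) or on the tail (κ = e)
  (j-attained : (Fin r × j ≡ 2) ⊎ Σ (Fin s) (λ i → e (r ↑ʳ i) ≡ j))
  where

  δ : Fin (r + s) → ℕ
  δ = replicate r 1 ++ replicate s 0

  open PowerRescaling p a e δ j

  δ-head : ∀ i → δ (i ↑ˡ s) ≡ 1
  δ-head = lookup-++ˡ (replicate r 1) (replicate s 0)

  δ-tail : ∀ i → δ (r ↑ʳ i) ≡ 0
  δ-tail = lookup-++ʳ (replicate r 1) (replicate s 0)

  κ-head : ∀ i → κ (i ↑ˡ s) ≡ 2
  κ-head i rewrite e-head i | δ-head i = refl

  κ-tail : ∀ i → κ (r ↑ʳ i) ≡ e (r ↑ʳ i)
  κ-tail i rewrite δ-tail i = trans (ℕₚ.+-identityʳ _) (ℕₚ.+-identityʳ _)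

  j≤κ : ∀ i → j ≤ κ i
  j≤κ = ↑-elim r (λ i → subst (j ≤_) (sym (κ-head i)) j≤2)
                 (λ i → subst (j ≤_) (sym (κ-tail i)) (j≤e-tail i))

  open Rescaling g h t (p ^ j) (g*t²≡p^j*h j≤κ)

  g-head : ∀ i → g (i ↑ˡ s) ≡ a (i ↑ˡ s)
  g-head i = trans (cong (λ z → p ^ z * a (i ↑ˡ s)) (e-head i)) (ℕₚ.*-identityˡ _)

  m∣g-tail : ∀ i → m ∣ g (r ↑ʳ i)
  m∣g-tail i = ℕ∣.∣-trans m∣p^j (ℕ∣.∣m⇒∣m*n (a (r ↑ʳ i)) (m^n∣m^o p (j≤e-tail i)))

  t-head : ∀ i → t (i ↑ˡ s) ≡ p
  t-head i = trans (cong (p ^_) (δ-head i)) (ℕₚ.*-identityʳ p)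

  t-tail : ∀ i → t (r ↑ʳ i) ≡ 1
  t-tail i = cong (p ^_) (δ-tail i)

  m∣t²×m∣2t-or-m∣g : ∀ i → ((m ∣ t i * t i) × (m ∣ t i + t i)) ⊎ (m ∣ g i)
  m∣t²×m∣2t-or-m∣g = ↑-elim r
    (λ i → inj₁ (subst (λ z → (m ∣ z * z) × (m ∣ z + z)) (sym (t-head i)) (m∣p*p , m∣p+p)))
    (λ i → inj₂ (m∣g-tail i))
    where
    m∣p*p : m ∣ p * p
    m∣p*p = ℕ∣.∣-trans m∣p^j (subst (p ^ j ∣_) (cong (_*_ p) (ℕₚ.*-identityʳ p)) (m^n∣m^o p j≤2))

  tᵢeᵢ∈Λ : ScaledBasisInΛ m
  tᵢeᵢ∈Λ i with m∣t²×m∣2t-or-m∣g i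
  ... | inj₁ (m∣t² , m∣2t) = ℕ∣.∣n⇒∣m*n (g i) m∣t² , ℕ∣.∣n⇒∣m*n (g i) m∣2t
  ... | inj₂ m∣g           = ℕ∣.∣m⇒∣m*n (t i * t i) m∣g , ℕ∣.∣m⇒∣m*n (t i + t i) m∣g

  m∣Q⇒t∣ : DivisibleNormInSpan m
  m∣Q⇒t∣ y m∣Q = ↑-elim r head tail
    where
    Y : Fin (r + s) → ℕ
    Y i = ∣ y i ∣
    norm : Fin (r + s) → ℕ
    norm i = g i * (Y i * Y i)
    m∣head+tail : m ∣ sum (norm ∘ (_↑ˡ s)) + sum (norm ∘ (r ↑ʳ_))
    m∣head+tail = subst (m ∣_) (sum-splitAt r norm) (subst (λ z → m ∣ ∣ z ∣) (Q-diagMat g y) m∣Q)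
    m∣tail : m ∣ sum (norm ∘ (r ↑ʳ_))
    m∣tail = ∣-sum λ i → ℕ∣.∣m⇒∣m*n (Y (r ↑ʳ i) * Y (r ↑ʳ i)) (m∣g-tail i)
    m∣head : m ∣ sum (λ i → a (i ↑ˡ s) * (Y (i ↑ˡ s) * Y (i ↑ˡ s)))
    m∣head = subst (m ∣_) (sum-cong-≗ λ i → cong (_* (Y (i ↑ˡ s) * Y (i ↑ˡ s))) (g-head i))
               (ℕ∣.∣m+n∣m⇒∣n (subst (m ∣_) (ℕₚ.+-comm (sum (norm ∘ (_↑ˡ s))) _) m∣head+tail) m∣tail)
    head : ∀ i → t (i ↑ˡ s) ∣ Y (i ↑ˡ s)
    head i rewrite t-head i = head-anisotropic (Y ∘ (_↑ˡ s)) m∣head i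
    tail : ∀ i → t (r ↑ʳ i) ∣ Y (r ↑ʳ i)
    tail i rewrite t-tail i = ℕ∣.1∣ _

  λ-head : SetwiseCoprime g → Regular G → LambdaRegularDiagonal m G
  λ-head g-coprime = λ-rescaled m (h-positive p-prime a>0) (ℕₚ.m^n>0 p {{prime⇒nonZero p-prime}} j)
                       (h-setwiseCoprime p-prime p∤a attained g-coprime) m∣p^j tᵢeᵢ∈Λ m∣Q⇒t∣
    where
    attained : Σ (Fin (r + s)) λ i → κ i ≡ j
    attained = [ (λ (i , j≡2) → i ↑ˡ s , trans (κ-head i) (sym j≡2))
               , (λ (i , e≡j) → r ↑ʳ i , trans (κ-tail i) e≡j) ]′ j-attained

λ-prime-head : ∀ {r s p} → Prime p → (a e : Fin (suc r + suc s) → ℕ) → (∀ i → 0 < a i) →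
               (∀ i → ¬ p ∣ a i) → (∀ i → e (i ↑ˡ suc s) ≡ 0) →
               (∀ i → e (suc r ↑ʳ zero) ≤ e (suc r ↑ʳ i)) → 1 ≤ e (suc r ↑ʳ zero) →
               Anisotropic p p (λ i → a (i ↑ˡ suc s)) →
               SetwiseCoprime (λ i → p ^ e i * a i) → Regular (diagMat (λ i → + (p ^ e i * a i))) →
               LambdaRegularDiagonal p (diagMat (λ i → + (p ^ e i * a i)))
λ-prime-head {r} {p = p} p-prime a e a>0 p∤a e-head e-mono e₁≥1 anisotropic with e (suc r ↑ʳ zero) in e₁≡
... | 1 = HeadRescaling.λ-head p-prime a e a>0 p∤a e-head p 1 (s≤s z≤n) e-mono (ℕ∣.m∣m*n 1)
            (ℕ∣.∣m∣n⇒∣m+n ℕ∣.∣-refl ℕ∣.∣-refl) anisotropic (inj₂ (zero , e₁≡))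
... | suc (suc _) = HeadRescaling.λ-head p-prime a e a>0 p∤a e-head p 2 ℕₚ.≤-refl
            (λ i → ℕₚ.≤-trans (s≤s (s≤s z≤n)) (e-mono i)) (ℕ∣.m∣m*n (p * 1))
            (ℕ∣.∣m∣n⇒∣m+n ℕ∣.∣-refl ℕ∣.∣-refl) anisotropic (inj₁ (zero , refl))

λ-dyadic-head : ∀ {r s p} → p ≡ 2 → Prime p → (a e : Fin (suc r + s) → ℕ) → (∀ i → 0 < a i) →
                (∀ i → ¬ p ∣ a i) → (∀ i → e (i ↑ˡ s) ≡ 0) → (∀ i → 2 ≤ e (suc r ↑ʳ i)) →
                suc r < 4 → (∀ i → a (i ↑ˡ s) % 4 ≡ a zero % 4) →
                SetwiseCoprime (λ i → p ^ e i * a i) → Regular (diagMat (λ i → + (p ^ e i * a i))) →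
                LambdaRegularDiagonal 4 (diagMat (λ i → + (p ^ e i * a i)))
λ-dyadic-head {s = s} refl p-prime a e a>0 p∤a e-head e-tail r<4 residues =
  HeadRescaling.λ-head p-prime a e a>0 p∤a e-head 4 2 ℕₚ.≤-refl e-tail ℕ∣.∣-refl ℕ∣.∣-refl
    (anisotropic-mod-4 (λ i → a (i ↑ˡ s)) (a zero) (p∤a zero) residues r<4) (inj₁ (zero , refl))

factor∣prodFinℕ : ∀ {k} (a : Fin k → ℕ) i → a i ∣ prodFinℕ a
factor∣prodFinℕ a zero    = ℕ∣.m∣m*n _
factor∣prodFinℕ a (suc i) = ℕ∣.∣n⇒∣m*n (a zero) (factor∣prodFinℕ (a ∘ suc) i)

coprime-prodFinℕ⇒∤ : ∀ {k p} (a : Fin k → ℕ) → Prime p → Coprime p (prodFinℕ a) → ∀ i → ¬ p ∣ a i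
coprime-prodFinℕ⇒∤ a p-prime p⊥a i p∣aᵢ =
  nonTrivial⇒≢1 {{prime⇒nonTrivial p-prime}} (p⊥a (ℕ∣.∣-refl , ℕ∣.∣-trans p∣aᵢ (factor∣prodFinℕ a i)))

lemma2p4 : (n p : ℕ) → Prime p →
    (a e : Fin (4 + n) → ℕ) →
    (∀ i → 1 ≤ a i) →
    e zero ≡ 0 →
    (∀ i j → i F.≤ j → e i ≤ e j) →
    Coprime p (prodFinℕ a) →
    Primitive (diagMat (λ i → + (p ^ e i * a i))) →
    Regular (diagMat (λ i → + (p ^ e i * a i))) →
    ((p ≡ 2 → 1 ≤ e (suc zero) →
        LambdaRegularDiagonal 2 (diagMat (λ i → + (p ^ e i * a i))))
    × (p ≡ 2 → e (suc zero) ≡ 0 → 2 ≤ e (suc (suc zero)) →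
        a zero % 4 ≡ a (suc zero) % 4 →
        LambdaRegularDiagonal 4 (diagMat (λ i → + (p ^ e i * a i))))
    × (p ≡ 2 → e (suc zero) ≡ 0 → e (suc (suc zero)) ≡ 0 →
        2 ≤ e (suc (suc (suc zero))) →
        a zero % 4 ≡ a (suc zero) % 4 → a (suc zero) % 4 ≡ a (suc (suc zero)) % 4 →
        LambdaRegularDiagonal 4 (diagMat (λ i → + (p ^ e i * a i))))
    × (p ≢ 2 → 1 ≤ e (suc zero) →
        LambdaRegularDiagonal p (diagMat (λ i → + (p ^ e i * a i))))
    × (p ≢ 2 → e (suc zero) ≡ 0 → 1 ≤ e (suc (suc zero)) →
        LegendreMinusOne (- (+ (a zero * a (suc zero)))) p →
        LambdaRegularDiagonal p (diagMat (λ i → + (p ^ e i * a i)))))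
lemma2p4 n p p-prime a e a>0 e₀≡0 e-mono p⊥a isPrimitive regular =
    (λ { refl → λ-single-head })
  , (λ p≡2 e₁≡0 e₂≥2 a₀≡a₁ → λ-dyadic-head {r = 1} p≡2 p-prime a e a>0 p∤a
       (λ { zero → e₀≡0 ; (suc zero) → e₁≡0 }) (λ i → ℕₚ.≤-trans e₂≥2 (e-mono _ _ (s≤s (s≤s z≤n))))
       (s≤s (s≤s (s≤s z≤n))) (λ { zero → refl ; (suc zero) → sym a₀≡a₁ }) g-coprime regular)
  , (λ p≡2 e₁≡0 e₂≡0 e₃≥2 a₀≡a₁ a₁≡a₂ → λ-dyadic-head {r = 2} p≡2 p-prime a e a>0 p∤a
       (λ { zero → e₀≡0 ; (suc zero) → e₁≡0 ; (suc (suc zero)) → e₂≡0 })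
       (λ i → ℕₚ.≤-trans e₃≥2 (e-mono _ _ (s≤s (s≤s (s≤s z≤n))))) (s≤s (s≤s (s≤s (s≤s z≤n))))
       (λ { zero → refl ; (suc zero) → sym a₀≡a₁ ; (suc (suc zero)) → sym (trans a₀≡a₁ a₁≡a₂) })
       g-coprime regular)
  , (λ _ → λ-single-head)
  , (λ _ e₁≡0 e₂≥1 legendre → λ-prime-head {r = 1} p-prime a e a>0 p∤a
       (λ { zero → e₀≡0 ; (suc zero) → e₁≡0 }) (λ i → e-mono _ _ (s≤s (s≤s z≤n))) e₂≥1
       (legendre⇒anisotropic (λ i → a (i ↑ˡ 2 + n)) p-prime legendre) g-coprime regular)
  where
  p∤a : ∀ i → ¬ p ∣ a i
  p∤a = coprime-prodFinℕ⇒∤ a p-prime p⊥a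
  g-coprime : SetwiseCoprime (λ i → p ^ e i * a i)
  g-coprime = primitive⇒setwiseCoprime _ isPrimitive
  λ-single-head : 1 ≤ e (suc zero) → LambdaRegularDiagonal p (diagMat (λ i → + (p ^ e i * a i)))
  λ-single-head e₁≥1 = λ-prime-head {r = 0} p-prime a e a>0 p∤a (λ { zero → e₀≡0 })
    (λ i → e-mono _ _ (s≤s z≤n)) e₁≥1 (anisotropic-rank-1 (λ i → a (i ↑ˡ 3 + n)) p-prime (p∤a zero))
    g-coprime regular
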